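{- For every graph $G$ with $\mathit{elb}(G) \ge 2$ and $\sigma(G) \ge 3$, $$2^{2^{\mathit{elb}(G)-2}} < \chi(G) \le 2^{2^{\mathit{elb}(G)-1}}$$ and $$2^{2^{(\sigma(G)/2)-2}} < \chi(G) \le \sigma(G) + 2^{\left(2^{(\sigma(G)-1)}-\sigma(G)-1\right)}.$$
   Context: $\chi(G)$ is the chromatic number of $G$. An orientation covering of $G$ is a set of orientations $\overrightarrow{G_1},\dots,\overrightarrow{G_k}$ of $G$ such that for every vertex $u$ and any two distinct neighbors $v,w$ of $u$, some $\overrightarrow{G_i}$ contains both arcs $\overrightarrow{uv}$ and $\overrightarrow{uw}$; $\sigma(G)$ is the minimum size of an orientation covering. An elbow covering of $G$ is a set of orientations of $G$ such that for every path $u,v,w$ of $G$ (i.e. $uv,vw\in E(G)$, $u\ne w$) some orientation in the set does not have $u,v,w$ as a directed path; $\mathit{elb}(G)$ is the minimum size of an elbow covering. -}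

module Defs where

open import Data.Nat using (ℕ; _+_; _*_; _^_; _≤_; _<_)
open import Data.Fin using (Fin)
open import Data.Bool using (Bool; true; not)
open import Data.List using (List; length)
open import Data.List.Relation.Unary.Any using (Any)
open import Data.Product using (Σ; ∃; ∃-syntax; _×_)
open import Data.Sum using (_⊎_)
open import Data.Empty using (⊥)
open import Relation.Nullary using (¬_)
open import Relation.Binary.PropositionalEquality using (_≡_; _≢_)

record Graph (n : ℕ) : Set₁ where
  field
    Adj     : Fin n → Fin n → Set
    sym     : ∀ {u v} → Adj u v → Adj v u
    irrefl  : ∀ {u} → Adj u u → ⊥
open Graph public

Proper : ∀ {n} (G : Graph n) (k : ℕ) → (Fin n → Fin k) → Set
Proper G k c = ∀ u v → Adj G u v → c u ≢ c v

Colourable : ∀ {n} → Graph n → ℕ → Set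
Colourable {n} G k = Σ (Fin n → Fin k) (Proper G k)

IsChromaticNumber : ∀ {n} → Graph n → ℕ → Set
IsChromaticNumber G k = Colourable G k × (∀ j → Colourable G j → k ≤ j)

-- An orientation of G: for each edge uv exactly one of u→v, v→u.
-- (Values of the Bool function on non-edges are irrelevant.)
Orientation : ∀ {n} → Graph n → Set
Orientation {n} G = Σ (Fin n → Fin n → Bool) λ o → ∀ u v → Adj G u v → o u v ≡ not (o v u)

Arc : ∀ {n} (G : Graph n) → Orientation G → Fin n → Fin n → Set
Arc G (o Data.Product., _) u v = Adj G u v × o u v ≡ true

OrientationCovering : ∀ {n} (G : Graph n) → List (Orientation G) → Set
OrientationCovering G Os =
  ∀ u v w → Adj G u v → Adj G u w → v ≢ w →
  Any (λ O → Arc G O u v × Arc G O u w) Os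

IsSigma : ∀ {n} → Graph n → ℕ → Set
IsSigma G s =
  (∃[ Os ] (length Os ≡ s × OrientationCovering G Os)) ×
  (∀ Os → OrientationCovering G Os → s ≤ length Os)

DirectedPath : ∀ {n} (G : Graph n) → Orientation G → Fin n → Fin n → Fin n → Set
DirectedPath G O u v w = (Arc G O u v × Arc G O v w) ⊎ (Arc G O w v × Arc G O v u)

ElbowCovering : ∀ {n} (G : Graph n) → List (Orientation G) → Set
ElbowCovering G Os =
  ∀ u v w → Adj G u v → Adj G v w → u ≢ w →
  Any (λ O → ¬ DirectedPath G O u v w) Os

IsElb : ∀ {n} → Graph n → ℕ → Set
IsElb G e =
  (∃[ Os ] (length Os ≡ e × ElbowCovering G Os)) ×
  (∀ Os → ElbowCovering G Os → e ≤ length Os)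

-- The real inequality  2^(2^((s/2) - 2)) < χ , encoded exactly in integers:
-- it is equivalent to  log₂ χ > sqrt(2^s / 16), i.e. to the existence of a
-- rational p/q (q > 0) with  p/q > sqrt(2^s/16)  (⇔ 2^s q² < 16 p²)  and
-- p/q ≤ log₂ χ  (⇔ 2^p ≤ χ^q).
SigmaLowerBound : ℕ → ℕ → Set
SigmaLowerBound s χ =
  ∃[ p ] ∃[ q ] (0 < q × (2 ^ s) * (q * q) < 16 * (p * p) × 2 ^ p ≤ χ ^ q)

{-# OPTIONS --safe #-}
module Submission where

-- A list of k orientations of G is recorded by the signature x u v ∈ {0,1}^k of every arc, whose
-- i-th bit says whether the i-th orientation directs uv from u to v; reversing an arc complements
-- its signature. The list is an elbow covering iff the signatures of the two arcs leaving the middle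
-- vertex of a 2-path agree in some bit, and an orientation covering iff they share a 1.
--
-- Upper bounds: colour v by the set of tails y of the arcs entering v with signature 0y. If an edge
-- vu whose arc reads x v u = 0y had equally coloured ends, some neighbour w of u would have
-- x u w = x v u, the complement of x u v, which an elbow covering forbids; so χ ≤ 2^(2^(elb−1)).
-- For an orientation covering only tails with at least two 1s and one 0 need recording: the tail 0…0
-- forces v to be a sink of degree one, a single 1 makes v a source of that orientation, and 1…1
-- makes u a source of the first one; a source of the i-th orientation gets colour i, and a sink
-- reuses colour 0 or 1.
--
-- Lower bounds: a colouring by subsets of {0, …, 2^k − 1} orients each edge by the first element on
-- which the sets of its ends differ and the side containing it, which yields an elbow covering by
-- k + 1 orientations; so χ > 2^(2^(elb−2)). Adding reversals turns an elbow covering into an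
-- orientation covering, so σ ≤ 2 elb, and the lower bound on σ follows from the one on elb.

open import Defs renaming (sym to Adj-sym)
open import Data.Nat using (ℕ; zero; suc; _+_; _*_; _∸_; _^_; _≤_; _<_; _≤?_; z≤n; s≤s; pred; NonZero)
open import Data.Nat.Properties
  using ( suc-injective; pred-mono-≤; +-identityʳ; +-comm; +-suc; ∸-+-assoc; m+n∸n≡m; ≰⇒>; 1+n≰n
        ; ≤-reflexive; *-identityʳ; *-comm; m≤m+n; *-monoʳ-≤; *-monoˡ-≤; *-cancelʳ-≤; *-monoʳ-<; *-mono-<
        ; n<1+n; m^n>0; m^n≢0; ^-monoʳ-≤; ^-monoˡ-≤; ^-distribˡ-+-*; ^-*-assoc; module ≤-Reasoning)
open import Data.Nat.Tactic.RingSolver using (solve-∀)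
open import Data.Fin as Fin using (Fin; zero; suc)
open import Data.Fin.Properties using (2↔Bool; *↔×; +↔⊎; inject≤-injective; any?; all?) renaming (_≟_ to _≟ᶠ_)
open import Data.Bool using (Bool; true; false; not; _xor_)
open import Data.Bool.Properties
  using (not-involutive; not-¬; ¬-not; not-distribˡ-xor; xor-assoc; xor-same; xor-identityʳ) renaming (_≟_ to _≟ᵇ_)
open import Data.Maybe as Maybe using (Maybe; just; nothing)
open import Data.Vec using (Vec; []; _∷_; lookup; tabulate; map; replicate; tail)
open import Data.Vec.Properties
  using (lookup∘tabulate; lookup-replicate; lookup-map; map-∘; map-cong; map-id; ∷-injective)
  renaming (≡-dec to ≡-decᵛ)
open import Data.List as List using (List; _∷_; length; _++_)
open import Data.List.Properties using (length-++; length-map; length-tabulate)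
open import Data.List.Membership.Propositional using (_∈_)
open import Data.List.Relation.Unary.Any as Any using (here)
open import Data.List.Relation.Unary.Any.Properties using (lookup-index; tabulate⁺; Any-⊎⁻; ++⁺ˡ; ++⁺ʳ; map⁺)
open import Data.Product using (Σ; ∃; _×_; _,_; proj₁; proj₂)
open import Data.Product.Function.NonDependent.Propositional using (_×-↔_)
open import Data.Sum using (_⊎_; inj₁; inj₂; [_,_]′)
open import Data.Sum.Properties using (inj₁-injective; inj₂-injective) renaming (≡-dec to ≡-decˢ)
open import Data.Sum.Function.Propositional using (_⊎-↔_)
open import Data.Empty using (⊥-elim)
open import Function using (_↣_; _↔_; Injection; Inverse; mk↔ₛ′; _∘_)
open import Function.Properties.Inverse using (↔⇒↣; ↔-sym; ↔-refl)
open import Function.Construct.Composition using (_↔-∘_)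
open import Relation.Nullary using (¬_; Dec; yes; no; does)
open import Relation.Nullary.Decidable using (_×-dec_; _→-dec_; decidable-stable; ¬¬-excluded-middle)
open import Relation.Binary.PropositionalEquality

Vec↔× : ∀ {A : Set} {k} → Vec A (suc k) ↔ (A × Vec A k)
Vec↔× = mk↔ₛ′ (λ { (a ∷ v) → a , v }) (λ (a , v) → a ∷ v) (λ _ → refl) (λ { (_ ∷ _) → refl })

Vec↔Fin^ : ∀ {A : Set} {m} → A ↔ Fin m → ∀ k → Vec A k ↔ Fin (m ^ k)
Vec↔Fin^ A↔Fin zero    = mk↔ₛ′ (λ _ → zero) (λ _ → []) (λ { zero → refl }) (λ { [] → refl })
Vec↔Fin^ A↔Fin (suc k) = ↔-sym *↔× ↔-∘ ((A↔Fin ×-↔ Vec↔Fin^ A↔Fin k) ↔-∘ Vec↔×)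

Bits↔Fin : ∀ k → Vec Bool k ↔ Fin (2 ^ k)
Bits↔Fin = Vec↔Fin^ (↔-sym 2↔Bool)

firstDifference : ∀ {m} → Vec Bool m → Vec Bool m → Maybe (Fin m)
firstDifference []          []          = nothing
firstDifference (false ∷ x) (true ∷ y)  = just zero
firstDifference (true ∷ x)  (false ∷ y) = just zero
firstDifference (false ∷ x) (false ∷ y) = Maybe.map suc (firstDifference x y)
firstDifference (true ∷ x)  (true ∷ y)  = Maybe.map suc (firstDifference x y)

firstDifference-comm : ∀ {m} (x y : Vec Bool m) → firstDifference x y ≡ firstDifference y x
firstDifference-comm []          []          = refl
firstDifference-comm (false ∷ x) (true ∷ y)  = refl
firstDifference-comm (true ∷ x)  (false ∷ y) = refl
firstDifference-comm (false ∷ x) (false ∷ y) = cong (Maybe.map suc) (firstDifference-comm x y)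
firstDifference-comm (true ∷ x)  (true ∷ y)  = cong (Maybe.map suc) (firstDifference-comm x y)

firstDifference-differs : ∀ {m} (x y : Vec Bool m) {j} →
  firstDifference x y ≡ just j → lookup x j ≡ not (lookup y j)
firstDifference-differs (false ∷ x) (true ∷ y)  refl = refl
firstDifference-differs (true ∷ x)  (false ∷ y) refl = refl
firstDifference-differs (false ∷ x) (false ∷ y) eq with firstDifference x y in eq′
firstDifference-differs (false ∷ x) (false ∷ y) refl | just j = firstDifference-differs x y eq′
firstDifference-differs (true ∷ x)  (true ∷ y)  eq with firstDifference x y in eq′
firstDifference-differs (true ∷ x)  (true ∷ y)  refl | just j = firstDifference-differs x y eq′

firstDifference-≢ : ∀ {m} (x y : Vec Bool m) → x ≢ y → ∃ λ j → firstDifference x y ≡ just j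
firstDifference-≢ []          []          x≢y = ⊥-elim (x≢y refl)
firstDifference-≢ (false ∷ x) (true ∷ y)  _   = zero , refl
firstDifference-≢ (true ∷ x)  (false ∷ y) _   = zero , refl
firstDifference-≢ (false ∷ x) (false ∷ y) x≢y with firstDifference-≢ x y (x≢y ∘ cong (false ∷_))
... | j , eq = suc j , cong (Maybe.map suc) eq
firstDifference-≢ (true ∷ x)  (true ∷ y)  x≢y with firstDifference-≢ x y (x≢y ∘ cong (true ∷_))
... | j , eq = suc j , cong (Maybe.map suc) eq

mask : ∀ {m} → Bool → Vec Bool m → Vec Bool m
mask a = map (a xor_)

mask-involutive : ∀ {m} a (y : Vec Bool m) → mask a (mask a y) ≡ y
mask-involutive a y = begin
  map (a xor_) (map (a xor_) y)  ≡⟨ map-∘ (a xor_) (a xor_) y ⟨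
  map (λ b → a xor (a xor b)) y  ≡⟨ map-cong (λ b → trans (sym (xor-assoc a a b)) (cong (_xor b) (xor-same a))) y ⟩
  map (λ b → b) y                ≡⟨ map-id y ⟩
  y                              ∎
  where open ≡-Reasoning

mask-not : ∀ {m} a (y : Vec Bool m) → mask (not a) y ≡ map not (mask a y)
mask-not a y = trans (map-cong (λ b → sym (not-distribˡ-xor a b)) y) (map-∘ not (a xor_) y)

disagree⇒≡map-not : ∀ {m} (y z : Vec Bool m) → (∀ i → lookup y i ≢ lookup z i) → y ≡ map not z
disagree⇒≡map-not []      []      _        = refl
disagree⇒≡map-not (b ∷ y) (c ∷ z) disagree =
  cong₂ _∷_ (¬-not (disagree zero)) (disagree⇒≡map-not y z (disagree ∘ suc))

headFalse⇒≡false∷tail : ∀ {m} (y : Vec Bool (suc m)) → lookup y zero ≡ false → y ≡ false ∷ tail y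
headFalse⇒≡false∷tail (false ∷ _) refl = refl

ones zeros : ∀ {k} → Vec Bool k → ℕ
ones []          = 0
ones (true ∷ y)  = suc (ones y)
ones (false ∷ y) = ones y
zeros []          = 0
zeros (true ∷ y)  = zeros y
zeros (false ∷ y) = suc (zeros y)

OnlyTrueAt : ∀ {k} → Fin k → Vec Bool k → Set
OnlyTrueAt t y = lookup y t ≡ true × (∀ t′ → lookup y t′ ≡ true → t′ ≡ t)

onlyTrueAt-there : ∀ {k t} {y : Vec Bool k} → OnlyTrueAt t y → OnlyTrueAt (suc t) (false ∷ y)
onlyTrueAt-there (yₜ , unique) = yₜ , λ { zero () ; (suc t′) yₜ′ → cong suc (unique t′ yₜ′) }

ones≡0⇒≡replicate : ∀ {k} (y : Vec Bool k) → ones y ≡ 0 → y ≡ replicate k false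
ones≡0⇒≡replicate []          _  = refl
ones≡0⇒≡replicate (false ∷ y) eq = cong (false ∷_) (ones≡0⇒≡replicate y eq)

zeros≡0⇒≡replicate : ∀ {k} (y : Vec Bool k) → zeros y ≡ 0 → y ≡ replicate k true
zeros≡0⇒≡replicate []         _  = refl
zeros≡0⇒≡replicate (true ∷ y) eq = cong (true ∷_) (zeros≡0⇒≡replicate y eq)

ones≡1⇒onlyTrueAt : ∀ {k} (y : Vec Bool k) → ones y ≡ 1 → ∃ λ t → OnlyTrueAt t y
ones≡1⇒onlyTrueAt (true ∷ y) eq = zero , refl , onlyAtZero
  where
  onlyAtZero : ∀ t → lookup (true ∷ y) t ≡ true → t ≡ zero
  onlyAtZero zero     _   = refl
  onlyAtZero (suc t′) yₜ′
    with trans (sym yₜ′) (trans (cong (λ z → lookup z t′) (ones≡0⇒≡replicate y (suc-injective eq))) (lookup-replicate t′ false))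
  ... | ()
ones≡1⇒onlyTrueAt (false ∷ y) eq with ones≡1⇒onlyTrueAt y eq
... | t , only = suc t , onlyTrueAt-there only

balanced : ℕ → ℕ → ∀ k → List (Vec Bool k)
balanced a b zero    = empty a b
  where
  empty : ℕ → ℕ → List (Vec Bool 0)
  empty zero zero = List.[ [] ]
  empty _    _    = List.[]
balanced a b (suc k) = List.map (false ∷_) (balanced a (pred b) k) ++ List.map (true ∷_) (balanced (pred a) b k)

∈-balanced : ∀ {a b k} (y : Vec Bool k) → a ≤ ones y → b ≤ zeros y → y ∈ balanced a b k
∈-balanced {zero} {zero} [] _ _ = here refl
∈-balanced (false ∷ y) a≤ b≤ = ++⁺ˡ (map⁺ (Any.map (cong (false ∷_)) (∈-balanced y a≤ (pred-mono-≤ b≤))))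
∈-balanced (true ∷ y)  a≤ b≤ =
  ++⁺ʳ _ (map⁺ (Any.map (cong (true ∷_)) (∈-balanced y (pred-mono-≤ a≤) b≤)))

length-balanced-suc : ∀ a b k {d₁ d₂ d} → d₁ + d₂ ≡ d →
  length (balanced a (pred b) k) + d₁ ≡ 2 ^ k → length (balanced (pred a) b k) + d₂ ≡ 2 ^ k →
  length (balanced a b (suc k)) + d ≡ 2 ^ suc k
length-balanced-suc a b k {d₁} {d₂} refl eq₁ eq₂ = begin
  length (List.map (false ∷_) L₀ ++ List.map (true ∷_) L₁) + (d₁ + d₂)
    ≡⟨ cong (_+ (d₁ + d₂)) (trans (length-++ (List.map (false ∷_) L₀))
                                  (cong₂ _+_ (length-map (false ∷_) L₀) (length-map (true ∷_) L₁))) ⟩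
  (length L₀ + length L₁) + (d₁ + d₂) ≡⟨ interchange (length L₀) (length L₁) d₁ d₂ ⟩
  (length L₀ + d₁) + (length L₁ + d₂) ≡⟨ cong₂ _+_ eq₁ eq₂ ⟩
  2 ^ k + 2 ^ k                      ≡⟨ cong (2 ^ k +_) (sym (+-identityʳ (2 ^ k))) ⟩
  2 ^ suc k                          ∎
  where
  open ≡-Reasoning
  L₀ = balanced a (pred b) k
  L₁ = balanced (pred a) b k
  interchange : ∀ m n o p → (m + n) + (o + p) ≡ (m + o) + (n + p)
  interchange = solve-∀

length-balanced-0-0 : ∀ k → length (balanced 0 0 k) + 0 ≡ 2 ^ k
length-balanced-0-0 zero    = refl
length-balanced-0-0 (suc k) = length-balanced-suc 0 0 k refl (length-balanced-0-0 k) (length-balanced-0-0 k)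

length-balanced-1-0 : ∀ k → length (balanced 1 0 k) + 1 ≡ 2 ^ k
length-balanced-1-0 zero    = refl
length-balanced-1-0 (suc k) = length-balanced-suc 1 0 k refl (length-balanced-1-0 k) (length-balanced-0-0 k)

length-balanced-0-1 : ∀ k → length (balanced 0 1 k) + 1 ≡ 2 ^ k
length-balanced-0-1 zero    = refl
length-balanced-0-1 (suc k) = length-balanced-suc 0 1 k refl (length-balanced-0-0 k) (length-balanced-0-1 k)

length-balanced-2-0 : ∀ k → length (balanced 2 0 k) + suc k ≡ 2 ^ k
length-balanced-2-0 zero    = refl
length-balanced-2-0 (suc k) =
  length-balanced-suc 2 0 k (+-comm (suc k) 1) (length-balanced-2-0 k) (length-balanced-1-0 k)

length-balanced-1-1 : ∀ k → length (balanced 1 1 (suc k)) + 2 ≡ 2 ^ suc k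
length-balanced-1-1 k = length-balanced-suc 1 1 k refl (length-balanced-1-0 k) (length-balanced-0-1 k)

length-balanced-2-1 : ∀ k → 2 ^ (2 + k) ∸ (3 + k) ∸ 1 ≡ length (balanced 2 1 (2 + k))
length-balanced-2-1 k = begin
  2 ^ (2 + k) ∸ (3 + k) ∸ 1                ≡⟨ ∸-+-assoc (2 ^ (2 + k)) (3 + k) 1 ⟩
  2 ^ (2 + k) ∸ (3 + k + 1)                ≡⟨ cong (_∸ (3 + k + 1)) counted ⟨
  length R + (3 + k + 1) ∸ (3 + k + 1)     ≡⟨ m+n∸n≡m (length R) (3 + k + 1) ⟩
  length R                                 ∎
  where
  open ≡-Reasoning
  R = balanced 2 1 (2 + k)
  counted : length R + (3 + k + 1) ≡ 2 ^ (2 + k)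
  counted = length-balanced-suc 2 1 (suc k) (cong (2 +_) (+-suc k 1))
              (length-balanced-2-0 (suc k)) (length-balanced-1-1 k)

bits-cases : ∀ {k} (y : Vec Bool k) →
  y ≡ replicate k false ⊎ (∃ λ t → OnlyTrueAt t y) ⊎ y ≡ replicate k true ⊎ y ∈ balanced 2 1 k
bits-cases y with ones y in o | zeros y in z
... | 0           | _     = inj₁ (ones≡0⇒≡replicate y o)
... | 1           | _     = inj₂ (inj₁ (ones≡1⇒onlyTrueAt y o))
... | suc (suc _) | 0     = inj₂ (inj₂ (inj₁ (zeros≡0⇒≡replicate y z)))
... | suc (suc _) | suc _ =
  inj₂ (inj₂ (inj₂ (∈-balanced y (subst (2 ≤_) (sym o) (s≤s (s≤s z≤n))) (subst (1 ≤_) (sym z) (s≤s z≤n)))))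

does-transfer : ∀ {A B : Set} (a? : Dec A) (b? : Dec B) → does a? ≡ does b? → A → B
does-transfer _       (yes b) _  _ = b
does-transfer (no ¬a) (no _)  _  a = ⊥-elim (¬a a)

¬¬-∀Fin : ∀ m {P : Fin m → Set} → (∀ i → ¬ ¬ P i) → ¬ ¬ (∀ i → P i)
¬¬-∀Fin zero    _    ¬∀P = ¬∀P λ ()
¬¬-∀Fin (suc m) ¬¬P ¬∀P =
  ¬¬P zero λ P₀ → ¬¬-∀Fin m (¬¬P ∘ suc) λ Pₛ → ¬∀P λ { zero → P₀ ; (suc i) → Pₛ i }

DecAdj : ∀ {n} → Graph n → Set
DecAdj {n} G = ∀ u v → Dec (Adj G u v)

-- Adjacency is an arbitrary family of sets; since the bounds on χ are decidable
-- statements, we may nevertheless assume it decidable while proving them.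
with-decAdj : ∀ {n} (G : Graph n) {m k} → (DecAdj G → m ≤ k) → m ≤ k
with-decAdj {n} G {m} {k} bound = decidable-stable (m ≤? k) λ m≰k →
  ¬¬-∀Fin n (λ u → ¬¬-∀Fin n λ v → ¬¬-excluded-middle) (m≰k ∘ bound)

colourable-weaken : ∀ {n} (G : Graph n) {m k} → m ≤ k → Colourable G m → Colourable G k
colourable-weaken G m≤k (c , proper) =
  (λ v → Fin.inject≤ (c v) m≤k) , λ u v a eq → proper u v a (inject≤-injective m≤k m≤k _ _ eq)

colourable-↣ : ∀ {n} (G : Graph n) {C : Set} {k} → C ↣ Fin k →
  (c : Fin n → C) → (∀ {u v} → Adj G u v → c u ≢ c v) → Colourable G k
colourable-↣ G C↣Fin c proper = to ∘ c , λ u v a → proper a ∘ injective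
  where open Injection C↣Fin

module _ {n} (G : Graph n) where

  private
    adj-sym : ∀ {u v} → Adj G u v → Adj G v u
    adj-sym = Adj-sym G

  Signature : ℕ → Set
  Signature k = Fin n → Fin n → Vec Bool k

  Antisymmetric : ∀ {k} → Signature k → Set
  Antisymmetric x = ∀ {u v} → Adj G u v → ∀ i → lookup (x u v) i ≡ not (lookup (x v u) i)

  CoversElbows : ∀ {k} → Signature k → Set
  CoversElbows x = ∀ {u v w} → Adj G u v → Adj G v w → u ≢ w → ∃ λ i → lookup (x v u) i ≡ lookup (x v w) i

  CoversPairs : ∀ {k} → Signature k → Set
  CoversPairs x =
    ∀ {v u w} → Adj G v u → Adj G v w → u ≢ w → ∃ λ i → lookup (x v u) i ≡ true × lookup (x v w) i ≡ true

  coversPairs⇒coversElbows : ∀ {k} {x : Signature k} → CoversPairs x → CoversElbows x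
  coversPairs⇒coversElbows cov a b u≢w with cov (adj-sym a) b u≢w
  ... | i , xᵥᵤ , xᵥw = i , trans xᵥᵤ (sym xᵥw)

  out : Orientation G → Fin n → Fin n → Bool
  out = proj₁

  signature : (Os : List (Orientation G)) → Signature (length Os)
  signature Os v u = tabulate λ i → out (List.lookup Os i) v u

  signature-antisymmetric : ∀ Os → Antisymmetric (signature Os)
  signature-antisymmetric Os {u} {v} a i = begin
    lookup (signature Os u v) i        ≡⟨ lookup∘tabulate _ i ⟩
    out O u v                          ≡⟨ proj₂ O u v a ⟩
    not (out O v u)                    ≡⟨ cong not (lookup∘tabulate _ i) ⟨
    not (lookup (signature Os v u) i)  ∎
    where
    open ≡-Reasoning
    O = List.lookup Os i

  orientation : ∀ {k} (x : Signature k) → Antisymmetric x → Fin k → Orientation G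
  orientation x anti i = (λ u v → lookup (x u v) i) , λ u v a → anti a i

  orientations : ∀ {k} (x : Signature k) → Antisymmetric x → List (Orientation G)
  orientations x anti = List.tabulate (orientation x anti)

  directedPath⇒opposite : ∀ O {u v w} → DirectedPath G O u v w → out O v u ≡ not (out O v w)
  directedPath⇒opposite O (inj₁ ((a , uv) , (_ , vw))) = trans (proj₂ O _ _ (adj-sym a)) (cong not (trans uv (sym vw)))
  directedPath⇒opposite O (inj₂ ((b , wv) , (_ , vu))) =
    trans vu (sym (trans (cong not (proj₂ O _ _ (adj-sym b))) (trans (not-involutive _) wv)))

  opposite⇒directedPath : ∀ O {u v w} → Adj G u v → Adj G v w → out O v u ≡ not (out O v w) → DirectedPath G O u v w
  opposite⇒directedPath O {u} {v} {w} a b opp with out O v w in vw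
  ... | true  = inj₁ ((a , trans (proj₂ O u v a) (cong not opp)) , (b , refl))
  ... | false = inj₂ ((adj-sym b , trans (proj₂ O w v (adj-sym b)) (cong not vw)) , (adj-sym a , opp))

  ¬directedPath⇒sameSide : ∀ O {u v w} → Adj G u v → Adj G v w → ¬ DirectedPath G O u v w → out O v u ≡ out O v w
  ¬directedPath⇒sameSide O a b ¬dp =
    trans (¬-not (¬dp ∘ opposite⇒directedPath O a b)) (not-involutive _)

  elbowCovering⇒coversElbows : ∀ Os → ElbowCovering G Os → CoversElbows (signature Os)
  elbowCovering⇒coversElbows Os cov {u} {v} {w} a b u≢w = i , (begin
    lookup (signature Os v u) i  ≡⟨ lookup∘tabulate _ i ⟩
    out O v u                    ≡⟨ ¬directedPath⇒sameSide O a b (lookup-index p) ⟩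
    out O v w                    ≡⟨ lookup∘tabulate _ i ⟨
    lookup (signature Os v w) i  ∎)
    where
    open ≡-Reasoning
    p = cov u v w a b u≢w
    i = Any.index p
    O = List.lookup Os i

  coversElbows⇒elbowCovering : ∀ {k} (x : Signature k) (anti : Antisymmetric x) →
    CoversElbows x → ElbowCovering G (orientations x anti)
  coversElbows⇒elbowCovering x anti cov u v w a b u≢w with cov a b u≢w
  ... | i , same =
    tabulate⁺ {P = λ O → ¬ DirectedPath G O u v w} i (not-¬ same ∘ directedPath⇒opposite (orientation x anti i))

  orientationCovering⇒coversPairs : ∀ Os → OrientationCovering G Os → CoversPairs (signature Os)
  orientationCovering⇒coversPairs Os cov {v} {u} {w} a b u≢w =
    i , trans (lookup∘tabulate _ i) (proj₂ (proj₁ arcs)) , trans (lookup∘tabulate _ i) (proj₂ (proj₂ arcs))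
    where
    p = cov v u w a b u≢w
    i = Any.index p
    arcs = lookup-index p

  reverse : Orientation G → Orientation G
  reverse O = (λ u v → out O v u) , λ u v a → proj₂ O v u (adj-sym a)

  ¬directedPath⇒outward⊎inward : ∀ O {u v w} → Adj G v u → Adj G v w → ¬ DirectedPath G O u v w →
    (Arc G O v u × Arc G O v w) ⊎ (Arc G (reverse O) v u × Arc G (reverse O) v w)
  ¬directedPath⇒outward⊎inward O {u} {v} {w} a b ¬dp
    with out O v u in vu | ¬directedPath⇒sameSide O (adj-sym a) b ¬dp
  ... | true  | same = inj₁ ((a , refl) , (b , sym same))
  ... | false | same = inj₂ ((a , inward a vu) , (b , inward b (sym same)))
    where
    inward : ∀ {t} → Adj G v t → out O v t ≡ false → out O t v ≡ true
    inward c vt = trans (proj₂ O _ _ (adj-sym c)) (cong not vt)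

  elbowCovering⇒orientationCovering : ∀ Os → ElbowCovering G Os → OrientationCovering G (Os ++ List.map reverse Os)
  elbowCovering⇒orientationCovering Os cov v u w a b u≢w =
    [ ++⁺ˡ , ++⁺ʳ Os ∘ map⁺ ]′
      (Any-⊎⁻ (Any.map (λ {O} → ¬directedPath⇒outward⊎inward O a b) (cov u v w (adj-sym a) b u≢w)))

  headFalse-either : ∀ {k} (x : Signature (suc k)) → Antisymmetric x → ∀ {u v} → Adj G u v →
    lookup (x u v) zero ≡ false ⊎ lookup (x v u) zero ≡ false
  headFalse-either x anti {u} {v} a with lookup (x u v) zero in xᵤᵥ
  ... | false = inj₁ refl
  ... | true  = inj₂ (trans (anti (adj-sym a) zero) (cong not xᵤᵥ))

  successive-signatures-differ : ∀ {k} (x : Signature (suc k)) → Antisymmetric x → CoversElbows x →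
    ∀ {v u w} → Adj G v u → Adj G u w → x v u ≢ x u w
  successive-signatures-differ x anti cov {v} {u} {w} a b xᵥᵤ≡xᵤw with w ≟ᶠ v
  ... | yes refl = not-¬ (cong (λ y → lookup y zero) xᵥᵤ≡xᵤw) (anti a zero)
  ... | no w≢v with cov a b (w≢v ∘ sym)
  ...   | i , same = not-¬ (trans same (cong (λ y → lookup y i) (sym xᵥᵤ≡xᵤw))) (anti (adj-sym a) i)

module InCode {n} (G : Graph n) (dA : DecAdj G) {k} (x : Signature G (suc k)) (anti : Antisymmetric G x)
  (R : List (Vec Bool k)) where

  InArc : Fin n → Vec Bool k → Set
  InArc v y = ∃ λ u → Adj G v u × x v u ≡ false ∷ y

  inArc? : ∀ v y → Dec (InArc v y)
  inArc? v y = any? λ u → dA v u ×-dec ≡-decᵛ _≟ᵇ_ (x v u) (false ∷ y)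

  inCode : Fin n → Vec Bool (length R)
  inCode v = tabulate λ r → does (inArc? v (List.lookup R r))

  inCode-transfer : ∀ {v u y} → inCode v ≡ inCode u → y ∈ R → InArc v y → InArc u y
  inCode-transfer {v} {u} same y∈R rewrite lookup-index y∈R =
    does-transfer (inArc? v _) (inArc? u _)
      (trans (sym (lookup∘tabulate _ r)) (trans (cong (λ c → lookup c r) same) (lookup∘tabulate _ r)))
    where r = Any.index y∈R

  inCode-separates : CoversElbows G x → ∀ {v u} → Adj G v u → lookup (x v u) zero ≡ false →
    tail (x v u) ∈ R → inCode v ≢ inCode u
  inCode-separates cov {v} {u} a xᵥᵤ₀ y∈R same
    with inCode-transfer same y∈R (u , a , headFalse⇒≡false∷tail (x v u) xᵥᵤ₀)
  ... | w , b , xᵤw =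
    successive-signatures-differ G x anti cov a b (trans (headFalse⇒≡false∷tail (x v u) xᵥᵤ₀) (sym xᵤw))

coversElbows⇒colourable : ∀ {n} (G : Graph n) → DecAdj G → ∀ {k} (x : Signature G (suc k)) →
  Antisymmetric G x → CoversElbows G x → Colourable G (2 ^ 2 ^ k)
coversElbows⇒colourable G dA {k} x anti cov =
  subst (λ m → Colourable G (2 ^ m)) (trans (sym (+-identityʳ _)) (length-balanced-0-0 k))
    (colourable-↣ G (↔⇒↣ (Bits↔Fin _)) inCode proper)
  where
  open InCode G dA x anti (balanced 0 0 k)
  proper : ∀ {u v} → Adj G u v → inCode u ≢ inCode v
  proper a with headFalse-either G x anti a
  ... | inj₁ xᵤᵥ₀ = inCode-separates cov a xᵤᵥ₀ (∈-balanced _ z≤n z≤n)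
  ... | inj₂ xᵥᵤ₀ = ≢-sym (inCode-separates cov (Adj-sym G a) xᵥᵤ₀ (∈-balanced _ z≤n z≤n))

module _ {k : ℕ} where

  private
    bits : Fin (2 ^ k) → Vec Bool k
    bits = Inverse.from (Bits↔Fin k)

  arcCode : Bool → Fin (2 ^ k) → Vec Bool (suc k)
  arcCode a j = mask a (false ∷ bits j)

  arcCode-not : ∀ a j → arcCode (not a) j ≡ map not (arcCode a j)
  arcCode-not a j = mask-not a (false ∷ bits j)

  arcCode-injective : ∀ {a b j j′} → arcCode a j ≡ arcCode b j′ → a ≡ b × j ≡ j′
  arcCode-injective {a} {b} {j} {j′} eq with ∷-injective eq
  ... | heads , tails with trans (sym (xor-identityʳ a)) (trans heads (xor-identityʳ b))
  ...   | refl = refl , Injection.injective (↔⇒↣ (↔-sym (Bits↔Fin k))) (begin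
    bits j                    ≡⟨ mask-involutive a (bits j) ⟨
    mask a (mask a (bits j))  ≡⟨ cong (mask a) tails ⟩
    mask a (mask a (bits j′)) ≡⟨ mask-involutive a (bits j′) ⟩
    bits j′                   ∎)
    where open ≡-Reasoning

-- A colouring by subsets S v of {0, …, 2^k − 1}: the arc from u to v is coded by the first element j
-- on which S u and S v differ, masked by whether j ∈ S u, so that reversing the arc complements its code.
colourable⇒coversElbows : ∀ {n} (G : Graph n) {k} → Colourable G (2 ^ 2 ^ k) →
  Σ (Signature G (suc k)) λ x → Antisymmetric G x × CoversElbows G x
colourable⇒coversElbows {n} G {k} (c , proper) = x , anti , cov
  where
  S : Fin n → Vec Bool (2 ^ k)
  S = Inverse.from (Bits↔Fin (2 ^ k)) ∘ c

  S-proper : ∀ {u v} → Adj G u v → S u ≢ S v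
  S-proper a = proper _ _ a ∘ Injection.injective (↔⇒↣ (↔-sym (Bits↔Fin (2 ^ k))))

  codeAt : Maybe (Fin (2 ^ k)) → Vec Bool (2 ^ k) → Vec Bool (suc k)
  codeAt nothing  _ = replicate _ false
  codeAt (just j) s = arcCode {k} (lookup s j) j

  x : Signature G (suc k)
  x u v = codeAt (firstDifference (S u) (S v)) (S u)

  x-adjacent : ∀ {u v} → Adj G u v → ∃ λ j →
    x u v ≡ arcCode {k} (lookup (S u) j) j × x v u ≡ arcCode (lookup (S v) j) j × lookup (S u) j ≡ not (lookup (S v) j)
  x-adjacent {u} {v} a with firstDifference-≢ (S u) (S v) (S-proper a)
  ... | j , first = j , cong (λ m → codeAt m (S u)) first
                      , cong (λ m → codeAt m (S v)) (trans (firstDifference-comm (S v) (S u)) first)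
                      , firstDifference-differs (S u) (S v) first

  anti : Antisymmetric G x
  anti {u} {v} a i with x-adjacent a
  ... | j , xᵤᵥ , xᵥᵤ , differs = trans (cong (λ y → lookup y i) complement) (lookup-map i not (x v u))
    where
    open ≡-Reasoning
    complement : x u v ≡ map not (x v u)
    complement = begin
      x u v                                 ≡⟨ xᵤᵥ ⟩
      arcCode (lookup (S u) j) j            ≡⟨ cong (λ b → arcCode b j) differs ⟩
      arcCode (not (lookup (S v) j)) j      ≡⟨ arcCode-not (lookup (S v) j) j ⟩
      map not (arcCode (lookup (S v) j) j)  ≡⟨ cong (map not) xᵥᵤ ⟨
      map not (x v u)                       ∎

  leaving-arcs-not-complementary : ∀ {v u w} → Adj G v u → Adj G v w → x v u ≢ map not (x v w)
  leaving-arcs-not-complementary {v} {u} {w} a b complement with x-adjacent a | x-adjacent b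
  ... | j₁ , xᵥᵤ , _ | j₂ , xᵥw , _ with arcCode-injective {k} {lookup (S v) j₁} {not (lookup (S v) j₂)} (begin
    arcCode (lookup (S v) j₁) j₁        ≡⟨ xᵥᵤ ⟨
    x v u                               ≡⟨ complement ⟩
    map not (x v w)                     ≡⟨ cong (map not) xᵥw ⟩
    map not (arcCode (lookup (S v) j₂) j₂) ≡⟨ arcCode-not (lookup (S v) j₂) j₂ ⟨
    arcCode (not (lookup (S v) j₂)) j₂  ∎)
    where open ≡-Reasoning
  ...   | bit≡not-bit , refl = not-¬ refl bit≡not-bit

  cov : CoversElbows G x
  cov {u} {v} {w} a b _ with any? (λ i → lookup (x v u) i ≟ᵇ lookup (x v w) i)
  ... | yes agree = agree
  ... | no ¬agree =
    ⊥-elim (leaving-arcs-not-complementary (Adj-sym G a) b (disagree⇒≡map-not (x v u) (x v w) (λ i → ¬agree ∘ (i ,_))))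

elb-lowerBound : ∀ {n} (G : Graph n) {χ k} → IsChromaticNumber G χ → IsElb G (2 + k) → 2 ^ 2 ^ k < χ
elb-lowerBound G {χ} {k} (colouring , _) (_ , minimal) with χ ≤? 2 ^ 2 ^ k
... | no χ≰ = ≰⇒> χ≰
... | yes χ≤ with colourable⇒coversElbows G {k} (colourable-weaken G χ≤ colouring)
...   | x , anti , cov =
  ⊥-elim (1+n≰n (subst (2 + k ≤_) (length-tabulate (orientation G x anti))
                        (minimal _ (coversElbows⇒elbowCovering G x anti cov))))

module PairCovering {n} (G : Graph n) (dA : DecAdj G) {k} (x : Signature G (3 + k)) (anti : Antisymmetric G x)
  (cov : CoversPairs G x) where

  private
    adj-sym : ∀ {u v} → Adj G u v → Adj G v u
    adj-sym = Adj-sym G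

  R : List (Vec Bool (2 + k))
  R = balanced 2 1 (2 + k)

  open InCode G dA x anti R

  Source : Fin (3 + k) → Fin n → Set
  Source i v = ∀ u → Adj G v u → lookup (x v u) i ≡ true

  Sink : Fin n → Set
  Sink v = ∀ u → Adj G v u → x v u ≡ replicate _ false

  source? : ∀ v → Dec (∃ λ i → Source i v)
  source? v = any? λ i → all? λ u → dA v u →-dec lookup (x v u) i ≟ᵇ true

  sink? : ∀ v → Dec (Sink v)
  sink? v = all? λ u → dA v u →-dec ≡-decᵛ _≟ᵇ_ (x v u) (replicate _ false)

  Colour : Set
  Colour = Fin (3 + k) ⊎ Vec Bool (length R)

  _≟ᶜ_ : (c d : Colour) → Dec (c ≡ d)
  _≟ᶜ_ = ≡-decˢ _≟ᶠ_ (≡-decᵛ _≟ᵇ_)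

  preColour : Fin n → Colour
  preColour v with source? v
  ... | yes (i , _) = inj₁ i
  ... | no _        = inj₂ (inCode v)

  -- A sink has at most one neighbour (silent⇒unique-neighbour), so colour 0 or 1 is free for it.
  sinkColour : Fin n → Colour
  sinkColour v with any? (λ u → dA v u ×-dec preColour u ≟ᶜ inj₁ zero)
  ... | yes _ = inj₁ (suc zero)
  ... | no _  = inj₁ zero

  colour : Fin n → Colour
  colour v with sink? v
  ... | yes _ = sinkColour v
  ... | no _  = preColour v

  sources-independent : ∀ {i v u} → Source i v → Source i u → ¬ Adj G v u
  sources-independent {i} {v} {u} srcᵥ srcᵤ a =
    not-¬ (srcᵤ v (adj-sym a)) (trans (anti (adj-sym a) i) (cong not (srcᵥ u a)))

  sinks-independent : ∀ {v u} → Sink v → Sink u → ¬ Adj G v u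
  sinks-independent {v} {u} sinkᵥ sinkᵤ a =
    not-¬ (cong (λ y → lookup y zero) (sinkᵤ v (adj-sym a)))
          (trans (anti (adj-sym a) zero) (cong (λ y → not (lookup y zero)) (sinkᵥ u a)))

  silent⇒unique-neighbour : ∀ {v u w} → x v u ≡ replicate _ false → Adj G v u → Adj G v w → w ≡ u
  silent⇒unique-neighbour {v} {u} {w} silent a b with w ≟ᶠ u
  ... | yes w≡u = w≡u
  ... | no w≢u with cov a b (w≢u ∘ sym)
  ...   | i , xᵥᵤᵢ , _ with trans (sym xᵥᵤᵢ) (trans (cong (λ y → lookup y i) silent) (lookup-replicate i false))
  ...     | ()

  onlyTrueAt⇒source : ∀ {v u i} → Adj G v u → OnlyTrueAt i (x v u) → Source i v
  onlyTrueAt⇒source {v} {u} {i} a (xᵥᵤᵢ , unique) w b with w ≟ᶠ u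
  ... | yes refl = xᵥᵤᵢ
  ... | no w≢u with cov a b (w≢u ∘ sym)
  ...   | i′ , xᵥᵤᵢ′ , xᵥwᵢ′ = subst (λ t → lookup (x v w) t ≡ true) (unique i′ xᵥᵤᵢ′) xᵥwᵢ′

  silent⇒sink : ∀ {v u} → Adj G v u → x v u ≡ replicate _ false → Sink v
  silent⇒sink {v} a silent w b = subst (λ t → x v t ≡ replicate _ false) (sym (silent⇒unique-neighbour silent a b)) silent

  reversed-ones⇒onlyTrueAt-zero : ∀ {v u} → Adj G v u → x v u ≡ false ∷ replicate _ true → OnlyTrueAt zero (x u v)
  reversed-ones⇒onlyTrueAt-zero {v} {u} a ones = bit zero , λ
    { zero _ → refl
    ; (suc t) xᵤᵥₜ → ⊥-elim (not-¬ (sym (lookup-replicate t true)) (trans (sym xᵤᵥₜ) (bit (suc t)))) }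
    where
    bit : ∀ i → lookup (x u v) i ≡ not (lookup (false ∷ replicate _ true) i)
    bit i = trans (anti (adj-sym a) i) (cong (λ y → not (lookup y i)) ones)

  sinkColour-proper : ∀ {v u} → Sink v → Adj G v u → sinkColour v ≢ preColour u
  sinkColour-proper {v} {u} sinkᵥ a eq with any? (λ w → dA v w ×-dec preColour w ≟ᶜ inj₁ zero)
  ... | no none = none (u , a , sym eq)
  ... | yes (w , b , preColourʷ) with silent⇒unique-neighbour (sinkᵥ u a) a b
  ...   | refl with trans eq preColourʷ
  ...     | ()

  inner-separated : ∀ {v u} → ¬ (∃ λ i → Source i v) → ¬ Sink v → ¬ (∃ λ i → Source i u) →
    Adj G v u → lookup (x v u) zero ≡ false → inCode v ≢ inCode u
  inner-separated {v} {u} ¬srcᵥ ¬sinkᵥ ¬srcᵤ a xᵥᵤ₀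
    with bits-cases (tail (x v u)) | headFalse⇒≡false∷tail (x v u) xᵥᵤ₀
  ... | inj₁ zeros         | xᵥᵤ = ⊥-elim (¬sinkᵥ (silent⇒sink a (trans xᵥᵤ (cong (false ∷_) zeros))))
  ... | inj₂ (inj₁ (t , only)) | xᵥᵤ =
    ⊥-elim (¬srcᵥ (suc t , onlyTrueAt⇒source a (subst (OnlyTrueAt (suc t)) (sym xᵥᵤ) (onlyTrueAt-there only))))
  ... | inj₂ (inj₂ (inj₁ ones)) | xᵥᵤ =
    ⊥-elim (¬srcᵤ (zero , onlyTrueAt⇒source (adj-sym a)
                            (reversed-ones⇒onlyTrueAt-zero a (trans xᵥᵤ (cong (false ∷_) ones)))))
  ... | inj₂ (inj₂ (inj₂ y∈R)) | _ = inCode-separates (coversPairs⇒coversElbows G {x = x} cov) a xᵥᵤ₀ y∈R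

  preColour-proper : ∀ {v u} → ¬ Sink v → ¬ Sink u → Adj G v u → preColour v ≢ preColour u
  preColour-proper {v} {u} ¬sinkᵥ ¬sinkᵤ a with source? v | source? u
  ... | yes (_ , srcᵥ) | yes (_ , srcᵤ) = λ eq →
    sources-independent srcᵥ (subst (λ t → Source t u) (sym (inj₁-injective eq)) srcᵤ) a
  ... | yes _          | no _           = λ ()
  ... | no _           | yes _          = λ ()
  ... | no ¬srcᵥ       | no ¬srcᵤ       with headFalse-either G x anti a
  ...   | inj₁ xᵥᵤ₀ = inner-separated ¬srcᵥ ¬sinkᵥ ¬srcᵤ a xᵥᵤ₀ ∘ inj₂-injective
  ...   | inj₂ xᵤᵥ₀ = inner-separated ¬srcᵤ ¬sinkᵤ ¬srcᵥ (adj-sym a) xᵤᵥ₀ ∘ sym ∘ inj₂-injective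

  colour-proper : ∀ {v u} → Adj G v u → colour v ≢ colour u
  colour-proper {v} {u} a with sink? v | sink? u
  ... | yes sinkᵥ | yes sinkᵤ = ⊥-elim (sinks-independent sinkᵥ sinkᵤ a)
  ... | yes sinkᵥ | no _      = sinkColour-proper sinkᵥ a
  ... | no _      | yes sinkᵤ = ≢-sym (sinkColour-proper sinkᵤ (adj-sym a))
  ... | no ¬sinkᵥ | no ¬sinkᵤ = preColour-proper ¬sinkᵥ ¬sinkᵤ a

  colourable : Colourable G (3 + k + 2 ^ length R)
  colourable = colourable-↣ G (↔⇒↣ (↔-sym +↔⊎ ↔-∘ (↔-refl ⊎-↔ Bits↔Fin (length R)))) colour colour-proper

n^q*[n+q]≤n*[1+n]^q : ∀ n q → n ^ q * (n + q) ≤ n * (1 + n) ^ q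
n^q*[n+q]≤n*[1+n]^q n zero    = ≤-reflexive (trans (+-identityʳ (n + 0)) (trans (+-identityʳ n) (sym (*-identityʳ n))))
n^q*[n+q]≤n*[1+n]^q n (suc q) = begin
  n * n ^ q * (n + suc q)              ≤⟨ m≤m+n _ (n ^ q * q) ⟩
  n * n ^ q * (n + suc q) + n ^ q * q  ≡⟨ expand n (n ^ q) q ⟩
  (1 + n) * (n ^ q * (n + q))          ≤⟨ *-monoʳ-≤ (1 + n) (n^q*[n+q]≤n*[1+n]^q n q) ⟩
  (1 + n) * (n * (1 + n) ^ q)          ≡⟨ regroup n ((1 + n) ^ q) ⟩
  n * ((1 + n) * (1 + n) ^ q)          ∎
  where
  open ≤-Reasoning
  expand : ∀ n m q → n * m * (n + suc q) + m * q ≡ (1 + n) * (m * (n + q))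
  expand = solve-∀
  regroup : ∀ n m → (1 + n) * (n * m) ≡ n * ((1 + n) * m)
  regroup = solve-∀

2*n^n≤[1+n]^n : ∀ n .{{_ : NonZero n}} → 2 * n ^ n ≤ (1 + n) ^ n
2*n^n≤[1+n]^n n = *-cancelʳ-≤ (2 * n ^ n) ((1 + n) ^ n) n (begin
  2 * n ^ n * n       ≡⟨ double (n ^ n) n ⟩
  n ^ n * (n + n)     ≤⟨ n^q*[n+q]≤n*[1+n]^q n n ⟩
  n * (1 + n) ^ n     ≡⟨ *-comm n _ ⟩
  (1 + n) ^ n * n     ∎)
  where
  open ≤-Reasoning
  double : ∀ m n → 2 * m * n ≡ m * (n + n)
  double = solve-∀

-- The witness is p/q = M + 1/a with M = 2^k and a = 2^M: it exceeds M ≥ sqrt(2^s/16) as s ≤ 2k + 4,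
-- and 2^(p/q) = a·2^(1/a) ≤ 1 + a ≤ χ because (1 + 1/a)^a ≥ 2.
sigmaLowerBound-intro : ∀ {s χ} k → s ≤ (2 + k) + (2 + k) → 2 ^ 2 ^ k < χ → SigmaLowerBound s χ
sigmaLowerBound-intro {s} {χ} k s≤2e a<χ = suc (M * a) , a , m^n>0 2 M , p²-bound , 2^p-bound
  where
  M = 2 ^ k
  a = 2 ^ M
  instance
    a≢0 : NonZero a
    a≢0 = m^n≢0 2 M
  square : ∀ m → (2 * (2 * m)) * (2 * (2 * m)) ≡ 16 * (m * m)
  square = solve-∀
  regroup : ∀ m a → 16 * (m * m) * (a * a) ≡ 16 * ((m * a) * (m * a))
  regroup = solve-∀
  p²-bound : 2 ^ s * (a * a) < 16 * (suc (M * a) * suc (M * a))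
  p²-bound = begin-strict
    2 ^ s * (a * a)                 ≤⟨ *-monoˡ-≤ (a * a) (^-monoʳ-≤ 2 s≤2e) ⟩
    2 ^ ((2 + k) + (2 + k)) * (a * a) ≡⟨ cong (_* (a * a)) (trans (^-distribˡ-+-* 2 (2 + k) (2 + k)) (square M)) ⟩
    16 * (M * M) * (a * a)          ≡⟨ regroup M a ⟩
    16 * ((M * a) * (M * a))        <⟨ *-monoʳ-< 16 (*-mono-< (n<1+n (M * a)) (n<1+n (M * a))) ⟩
    16 * (suc (M * a) * suc (M * a)) ∎
    where open ≤-Reasoning
  2^p-bound : 2 ^ suc (M * a) ≤ χ ^ a
  2^p-bound = begin
    2 * 2 ^ (M * a)   ≡⟨ cong (2 *_) (sym (^-*-assoc 2 M a)) ⟩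
    2 * a ^ a         ≤⟨ 2*n^n≤[1+n]^n a ⟩
    (1 + a) ^ a       ≤⟨ ^-monoˡ-≤ a a<χ ⟩
    χ ^ a             ∎
    where open ≤-Reasoning

module _ {n} (G : Graph n) where

  elbowCovering⇒colourable : DecAdj G → ∀ Os {k} → ElbowCovering G Os → length Os ≡ suc k → Colourable G (2 ^ 2 ^ k)
  elbowCovering⇒colourable dA Os@(_ ∷ _) cov refl =
    coversElbows⇒colourable G dA (signature G Os) (signature-antisymmetric G Os) (elbowCovering⇒coversElbows G Os cov)

  orientationCovering⇒colourable : DecAdj G → ∀ Os {k} → OrientationCovering G Os → length Os ≡ 3 + k →
    Colourable G (3 + k + 2 ^ (2 ^ (2 + k) ∸ (3 + k) ∸ 1))
  orientationCovering⇒colourable dA Os@(_ ∷ _ ∷ _ ∷ Os′) cov refl =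
    subst (λ m → Colourable G (length Os + 2 ^ m)) (sym (length-balanced-2-1 (length Os′)))
      (PairCovering.colourable G dA (signature G Os) (signature-antisymmetric G Os) (orientationCovering⇒coversPairs G Os cov))

  elb-upperBound : ∀ {χ k} → IsChromaticNumber G χ → IsElb G (suc k) → χ ≤ 2 ^ 2 ^ k
  elb-upperBound (_ , minimal) ((Os , |Os| , cov) , _) =
    with-decAdj G λ dA → minimal _ (elbowCovering⇒colourable dA Os cov |Os|)

  sigma-upperBound : ∀ {χ k} → IsChromaticNumber G χ → IsSigma G (3 + k) →
    χ ≤ 3 + k + 2 ^ (2 ^ (2 + k) ∸ (3 + k) ∸ 1)
  sigma-upperBound (_ , minimal) ((Os , |Os| , cov) , _) =
    with-decAdj G λ dA → minimal _ (orientationCovering⇒colourable dA Os cov |Os|)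

  sigma≤elb+elb : ∀ {s e} → IsSigma G s → IsElb G e → s ≤ e + e
  sigma≤elb+elb {s} (_ , minimal) ((Os , refl , cov) , _) =
    subst (s ≤_) (trans (length-++ Os) (cong (length Os +_) (length-map (reverse G) Os)))
      (minimal _ (elbowCovering⇒orientationCovering G Os cov))

corollary14 : ∀ (n : ℕ) (G : Graph n) (χ s e : ℕ) →
    IsChromaticNumber G χ → IsSigma G s → IsElb G e →
    2 ≤ e → 3 ≤ s →
    (2 ^ (2 ^ (e ∸ 2)) < χ × χ ≤ 2 ^ (2 ^ (e ∸ 1))) ×
    (SigmaLowerBound s χ × χ ≤ s + 2 ^ (2 ^ (s ∸ 1) ∸ s ∸ 1))
corollary14 n G χ (suc (suc (suc _))) (suc (suc k)) chromatic σ elb (s≤s (s≤s _)) (s≤s (s≤s (s≤s _))) =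
  (elb-lower , elb-upperBound G chromatic elb) ,
  (sigmaLowerBound-intro k (sigma≤elb+elb G σ elb) elb-lower , sigma-upperBound G chromatic σ)
  where
  elb-lower : 2 ^ 2 ^ k < χ
  elb-lower = elb-lowerBound G chromatic elb
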